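{- Let $n\ge 3$ be odd and put $M=(n-1)^{n-1}$. Suppose that for every integer $x\ge 1$ $$\sum_{j=0}^{\frac{n-1}{2}}(-1)^j\binom{n}{2j+1}S_{n,0}\big((n-1)^{2j}x\big)=\sum_{j=0}^{n-1}S_{n,j}(x).$$ Let $J\subseteq\{1,2,\dots,\frac{n-3}{2}\}$ be any subset (possibly empty). For integers $x\ge 0$ and $0\le j\le \frac{n-3}{2}$ put $T_j(x)=S_{n,0}\big(\lfloor x/(n-1)^{n-1-2j}\rfloor\big)$ if $j\in J$ and $T_j(x)=S_{n,0}\big((n-1)^{2j}\lfloor x/M\rfloor\big)$ if $j\notin J$, and let $$\Sigma_J(x)=\sum_{j=0}^{\frac{n-3}{2}}(-1)^{\frac{n-3}{2}-j}\binom{n}{2j+1}T_j(x).$$ Define $\nu_n^{J}(x)=S_{n,0}(x)-\Sigma_J(x)$. Then the sequence $\big((-1)^{s_{n-1}(x)}\nu_n^{J}(x)\big)_{x\ge 0}$ is periodic with period $2n(n-1)^{n-1}$.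
   Context: For an integer $b\ge 2$ and integer $r\ge 0$, $s_b(r)$ denotes the sum of the digits of $r$ in base $b$. For integers $n\ge 3$, $0\le j\le n-1$ and $x\ge 0$, define $$S_{n,j}(x)=\sum_{0\le r<x,\; r\equiv j \pmod n}(-1)^{s_{n-1}(r)}.$$ -}

module Defs where

open import Data.Nat using (ℕ; zero; suc; _+_; _*_; _∸_; _^_; _/_; _%_; _≡ᵇ_)
open import Data.Bool using (Bool; true; false; if_then_else_)
open import Data.Integer using (ℤ; +_; -_)
import Data.Integer as ℤ

-- Floor division, with the (never used) junk value 0 for divisor 0.
div : ℕ → ℕ → ℕ
div m zero    = 0
div m (suc d) = m / suc d

-- Sum of the base-b digits, with `fuel` bounding the number of digits.
digitSumAux : (b : ℕ) → ℕ → ℕ → ℕ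
digitSumAux b zero     r = 0
digitSumAux zero (suc f) r = 0
digitSumAux (suc b) (suc f) r = r % suc b + digitSumAux (suc b) f (r / suc b)

-- s_b(r): sum of digits of r in base b (meaningful for b ≥ 2; r digits of fuel suffice).
s : ℕ → ℕ → ℕ
s zero          r = 0
s (suc zero)    r = 0
s (suc (suc c)) r = digitSumAux (suc (suc c)) r r

sgn : ℕ → ℤ
sgn zero          = + 1
sgn (suc zero)    = - (+ 1)
sgn (suc (suc k)) = sgn k

congb : ℕ → ℕ → ℕ → Bool
congb zero    j r = false
congb (suc m) j r = (r % suc m) ≡ᵇ j

S : ℕ → ℕ → ℕ → ℤ
S n j zero    = + 0
S n j (suc x) = S n j x ℤ.+ (if congb n j x then sgn (s (n ∸ 1) x) else + 0)

sumℤ : ℕ → (ℕ → ℤ) → ℤ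
sumℤ zero    f = + 0
sumℤ (suc k) f = sumℤ k f ℤ.+ f k

module Submission where

-- Write n = 2h + 3, B = n − 1 = 2h + 2, M = B^B, H = (n − 3)/2 = h and g(r) = (−1)^{s_B(r)};
-- split every y as y = qM + m with q = ⌊y/M⌋ and m = y mod M.
-- (1) Block lemma: if P = B^k ≡ 1 (mod n), the base-B digits of qP + c (c < P) are those of q
--     followed by those of c, so S_{n,0}(qP + m) = S_{n,0}(qP) + g(q)·R(q, m), where
--     R(q, m) = Σ_{r<m, n ∣ q+r} g(r) depends on q only modulo n.  M and every B^{2j} are
--     ≡ 1 (mod n), so this decomposes S_{n,0}(y) and every term T_j(y) of Σ_J(y).
-- (2) The assumed identity at x = q gives S_{n,0}(qM) − coarse(q) = σ·G(q), where coarse(q)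
--     collects the terms S_{n,0}(B^{2j} q) of Σ_J, σ = ±1, and G(q) = Σ_{r<q} g(r) is the sum
--     of all S_{n,j}(q).
-- (3) B is even, so g(2k+1) = −g(2k) and g(q)·G(q) is 0 or −1 according to the parity of q.
-- Hence f(y) = (−1)^{s_B(y)} ν(y) is a function of q mod 2n and of m: its period is 2nM.

open import Defs
open import Data.Nat using (ℕ; zero; suc; _+_; _*_; _∸_; _^_; _≤_; _<_; _/_; _%_; ⌊_/2⌋; _≡ᵇ_; z≤n; s≤s; NonZero)
open import Data.Nat.Properties
open import Data.Nat.DivMod
open import Data.Nat.Divisibility using (divides)
open import Data.Nat.Combinatorics using (_C_; nCn≡1)
import Data.Nat.Tactic.RingSolver as ℕ-Ring
open import Data.Bool using (Bool; true; false; if_then_else_)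
open import Data.Integer using (ℤ; +_; -_)
import Data.Integer as ℤ
import Data.Integer.Properties as ℤP
open import Data.Integer.Tactic.RingSolver using (solve-∀)
open import Data.Product using (_×_; _,_; ∃; proj₂)
open import Data.Sum using (_⊎_; inj₁; inj₂)
open import Data.Empty using (⊥-elim)
open import Relation.Nullary using (¬_; yes; no)
open import Relation.Nullary.Decidable using (dec-true; dec-false)
open import Relation.Binary.PropositionalEquality

sgn-suc : ∀ k → sgn (suc k) ≡ - sgn k
sgn-suc zero          = refl
sgn-suc (suc zero)    = refl
sgn-suc (suc (suc k)) = sgn-suc k

sgn-+ : ∀ a b → sgn (a + b) ≡ sgn a ℤ.* sgn b
sgn-+ zero    b = sym (ℤP.*-identityˡ (sgn b))
sgn-+ (suc a) b = begin
    sgn (suc (a + b))      ≡⟨ sgn-suc (a + b) ⟩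
    - sgn (a + b)          ≡⟨ cong -_ (sgn-+ a b) ⟩
    - (sgn a ℤ.* sgn b)    ≡⟨ ℤP.neg-distribˡ-* (sgn a) (sgn b) ⟩
    (- sgn a) ℤ.* sgn b    ≡⟨ cong (ℤ._* sgn b) (sym (sgn-suc a)) ⟩
    sgn (suc a) ℤ.* sgn b  ∎
  where open ≡-Reasoning

sgn-sq : ∀ a → sgn a ℤ.* sgn a ≡ + 1
sgn-sq zero          = refl
sgn-sq (suc zero)    = refl
sgn-sq (suc (suc a)) = sgn-sq a

sgn-∸ : ∀ K j → j ≤ K → sgn (K ∸ j) ≡ - (sgn (suc K) ℤ.* sgn j)
sgn-∸ K j j≤K = begin
    sgn (K ∸ j)                                   ≡⟨ sym (ℤP.*-identityʳ _) ⟩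
    sgn (K ∸ j) ℤ.* + 1                            ≡⟨ cong (sgn (K ∸ j) ℤ.*_) (sym (sgn-sq j)) ⟩
    sgn (K ∸ j) ℤ.* (sgn j ℤ.* sgn j)              ≡⟨ regroup (sgn (K ∸ j)) (sgn j) ⟩
    - ((- (sgn (K ∸ j) ℤ.* sgn j)) ℤ.* sgn j)      ≡⟨ cong (λ z → - (z ℤ.* sgn j)) (sym sgn-top) ⟩
    - (sgn (suc (K ∸ j + j)) ℤ.* sgn j)            ≡⟨ cong (λ z → - (sgn (suc z) ℤ.* sgn j)) (m∸n+n≡m j≤K) ⟩
    - (sgn (suc K) ℤ.* sgn j)                      ∎
  where
  open ≡-Reasoning
  regroup : ∀ a b → a ℤ.* (b ℤ.* b) ≡ - ((- (a ℤ.* b)) ℤ.* b)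
  regroup = solve-∀
  sgn-top : sgn (suc (K ∸ j + j)) ≡ - (sgn (K ∸ j) ℤ.* sgn j)
  sgn-top = trans (sgn-suc (K ∸ j + j)) (cong -_ (sgn-+ (K ∸ j) j))

if-scale : ∀ b a x → (if b then a ℤ.* x else + 0) ≡ a ℤ.* (if b then x else + 0)
if-scale true  a x = refl
if-scale false a x = sym (ℤP.*-zeroʳ a)

sumℤ-cong : ∀ N {f g : ℕ → ℤ} → (∀ j → j < N → f j ≡ g j) → sumℤ N f ≡ sumℤ N g
sumℤ-cong zero    eq = refl
sumℤ-cong (suc N) eq = cong₂ ℤ._+_ (sumℤ-cong N (λ j j<N → eq j (m<n⇒m<1+n j<N))) (eq N ≤-refl)

sumℤ-+ : ∀ N f g → sumℤ N (λ j → f j ℤ.+ g j) ≡ sumℤ N f ℤ.+ sumℤ N g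
sumℤ-+ zero    f g = refl
sumℤ-+ (suc N) f g = trans (cong (ℤ._+ (f N ℤ.+ g N)) (sumℤ-+ N f g))
                           (interchange (sumℤ N f) (sumℤ N g) (f N) (g N))
  where
  interchange : ∀ a b c d → (a ℤ.+ b) ℤ.+ (c ℤ.+ d) ≡ (a ℤ.+ c) ℤ.+ (b ℤ.+ d)
  interchange = solve-∀

sumℤ-*ˡ : ∀ N c f → sumℤ N (λ j → c ℤ.* f j) ≡ c ℤ.* sumℤ N f
sumℤ-*ˡ zero    c f = sym (ℤP.*-zeroʳ c)
sumℤ-*ˡ (suc N) c f = trans (cong (ℤ._+ (c ℤ.* f N)) (sumℤ-*ˡ N c f))
                            (sym (ℤP.*-distribˡ-+ c (sumℤ N f) (f N)))

sumℤ-zero : ∀ N → sumℤ N (λ _ → + 0) ≡ + 0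
sumℤ-zero zero    = refl
sumℤ-zero (suc N) = cong (ℤ._+ + 0) (sumℤ-zero N)

≡ᵇ-true : ∀ a → (a ≡ᵇ a) ≡ true
≡ᵇ-true a = dec-true (a ≟ a) refl

≡ᵇ-false : ∀ {a b} → ¬ (a ≡ b) → (a ≡ᵇ b) ≡ false
≡ᵇ-false {a} {b} = dec-false (a ≟ b)

sumℤ-indicator-below : ∀ K c v → K ≤ c → sumℤ K (λ j → if c ≡ᵇ j then v else + 0) ≡ + 0
sumℤ-indicator-below zero    c v _   = refl
sumℤ-indicator-below (suc K) c v K<c =
  cong₂ ℤ._+_ (sumℤ-indicator-below K c v (<⇒≤ K<c))
              (cong (λ b → if b then v else + 0) (≡ᵇ-false (λ c≡K → <-irrefl (sym c≡K) K<c)))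

sumℤ-indicator : ∀ N c v → c < N → sumℤ N (λ j → if c ≡ᵇ j then v else + 0) ≡ v
sumℤ-indicator (suc N) c v c<1+N with c ≟ N
... | yes refl = trans (cong₂ ℤ._+_ (sumℤ-indicator-below c c v ≤-refl)
                                    (cong (λ b → if b then v else + 0) (≡ᵇ-true c)))
                       (ℤP.+-identityˡ v)
... | no c≢N   = trans (cong₂ ℤ._+_ (sumℤ-indicator N c v (≤∧≢⇒< (<⇒≤pred c<1+N) c≢N))
                                    (cong (λ b → if b then v else + 0) (≡ᵇ-false c≢N)))
                       (ℤP.+-identityʳ v)

module Digits (c : ℕ) where
  b : ℕ
  b = suc (suc c)

  -- Fuel bookkeeping: one quotient step of r ≤ f + 1 fits into fuel f, so extra fuel is harmless.
  private
    quotient≤fuel : ∀ r f → r ≤ suc f → r / b ≤ f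
    quotient≤fuel zero    f _   = z≤n
    quotient≤fuel (suc r) f r≤ = <⇒≤pred (≤-trans (m/n<m (suc r) b (s≤s (s≤s z≤n))) r≤)

    extra-fuel : ∀ f r → r ≤ f → digitSumAux b (suc f) r ≡ digitSumAux b f r
    extra-fuel zero    zero _  = refl
    extra-fuel (suc f) r    r≤ = cong (_+_ (r % b)) (extra-fuel f (r / b) (quotient≤fuel r f r≤))

    fuel-+ : ∀ d r → digitSumAux b (d + r) r ≡ s b r
    fuel-+ zero    r = refl
    fuel-+ (suc d) r = trans (extra-fuel (d + r) r (m≤n+m r d)) (fuel-+ d r)

  digitSum-fuel : ∀ f r → r ≤ f → digitSumAux b f r ≡ s b r
  digitSum-fuel f r r≤f = trans (cong (λ e → digitSumAux b e r) (sym (m∸n+n≡m r≤f))) (fuel-+ (f ∸ r) r)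

  digitSum-step : ∀ r → s b r ≡ r % b + s b (r / b)
  digitSum-step zero    = refl
  digitSum-step (suc r) = cong (_+_ (suc r % b)) (digitSum-fuel r (suc r / b) (quotient≤fuel (suc r) r ≤-refl))

  digitSum-low : ∀ r q → r < b → s b (r + q * b) ≡ r + s b q
  digitSum-low r q r<b = trans (digitSum-step (r + q * b)) (cong₂ _+_ last-digit (cong (s b) quotient))
    where
    last-digit : (r + q * b) % b ≡ r
    last-digit = trans ([m+kn]%n≡m%n r q b) (m<n⇒m%n≡m r<b)
    quotient : (r + q * b) / b ≡ q
    quotient = trans (+-distrib-/-∣ʳ r (divides q refl)) (cong₂ _+_ (m<n⇒m/n≡0 r<b) (m*n/n≡m q b))

  -- Concatenation: the digits of a·b^k + r (r < b^k) are those of a followed by those of r.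
  digitSum-concat : ∀ k a r → r < b ^ k → s b (a * b ^ k + r) ≡ s b a + s b r
  digitSum-concat zero    a zero    _          = trans (cong (s b) (trans (+-identityʳ _) (*-identityʳ a)))
                                                       (sym (+-identityʳ _))
  digitSum-concat zero    a (suc r) (s≤s ())
  digitSum-concat (suc k) a r       r<b^[1+k] = begin
      s b (a * b ^ suc k + r)                   ≡⟨ cong (s b) split-last ⟩
      s b (r % b + (a * b ^ k + r / b) * b)     ≡⟨ digitSum-low (r % b) (a * b ^ k + r / b) (m%n<n r b) ⟩
      r % b + s b (a * b ^ k + r / b)           ≡⟨ cong (_+_ (r % b)) (digitSum-concat k a (r / b) r/b<b^k) ⟩
      r % b + (s b a + s b (r / b))             ≡⟨ +-comm-left (r % b) (s b a) _ ⟩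
      s b a + (r % b + s b (r / b))             ≡⟨ cong (_+_ (s b a)) (sym (digitSum-step r)) ⟩
      s b a + s b r                             ∎
    where
    open ≡-Reasoning
    regroup : ∀ a p x y b → a * (b * p) + (x + y * b) ≡ x + (a * p + y) * b
    regroup = ℕ-Ring.solve-∀
    +-comm-left : ∀ x y z → x + (y + z) ≡ y + (x + z)
    +-comm-left = ℕ-Ring.solve-∀
    split-last : a * b ^ suc k + r ≡ r % b + (a * b ^ k + r / b) * b
    split-last = trans (cong (_+_ (a * b ^ suc k)) (m≡m%n+[m/n]*n r b)) (regroup a (b ^ k) (r % b) (r / b) b)
    r/b<b^k : r / b < b ^ k
    r/b<b^k = m<n*o⇒m/o<n (subst (r <_) (*-comm b (b ^ k)) r<b^[1+k])

digitSign : ℕ → ℕ → ℤ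
digitSign b r = sgn (s b r)

digitSignSum : ℕ → ℕ → ℤ
digitSignSum b zero    = + 0
digitSignSum b (suc q) = digitSignSum b q ℤ.+ digitSign b q

even-or-odd : ∀ q → ∃ λ k → q ≡ k + k ⊎ q ≡ suc (k + k)
even-or-odd zero    = 0 , inj₁ refl
even-or-odd (suc q) with even-or-odd q
... | k , inj₁ q≡2k   = k , inj₂ (cong suc q≡2k)
... | k , inj₂ q≡2k+1 = suc k , inj₁ (cong suc (trans q≡2k+1 (sym (+-suc k k))))

minusOdd : ℕ → ℤ
minusOdd zero          = + 0
minusOdd (suc zero)    = - (+ 1)
minusOdd (suc (suc q)) = minusOdd q

minusOdd-even : ∀ k → minusOdd (k + k) ≡ + 0
minusOdd-even zero    = refl
minusOdd-even (suc k) = trans (cong (λ z → minusOdd (suc z)) (+-suc k k)) (minusOdd-even k)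

minusOdd-odd : ∀ k → minusOdd (suc (k + k)) ≡ - (+ 1)
minusOdd-odd zero    = refl
minusOdd-odd (suc k) = trans (cong (λ z → minusOdd (suc (suc z))) (+-suc k k)) (minusOdd-odd k)

minusOdd-periodic : ∀ t q → minusOdd ((t + t) + q) ≡ minusOdd q
minusOdd-periodic zero    q = refl
minusOdd-periodic (suc t) q = trans (cong (λ z → minusOdd (suc (z + q))) (+-suc t t)) (minusOdd-periodic t q)

-- In an even base b = 2d the last digit of 2k is even and at most b − 2, so 2k + 1 has
-- digit sum one more than 2k: the digit signs cancel in consecutive pairs.
module EvenBase (h : ℕ) where
  open Digits (h + h) using (b; digitSum-low)

  d : ℕ
  d = suc h

  double-digits : ∀ k → k + k ≡ (k % d + k % d) + (k / d) * b
  double-digits k = trans (cong₂ _+_ k≡ k≡) (regroup (k % d) (k / d) h)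
    where
    k≡ : k ≡ k % d + (k / d) * d
    k≡ = m≡m%n+[m/n]*n k d
    regroup : ∀ r a h → (r + a * suc h) + (r + a * suc h) ≡ (r + r) + a * suc (suc (h + h))
    regroup = ℕ-Ring.solve-∀

  odd-last-digit<b : ∀ k → suc (k % d + k % d) < b
  odd-last-digit<b k = s≤s (s≤s (+-mono-≤ r≤h r≤h))
    where
    r≤h : k % d ≤ h
    r≤h = <⇒≤pred (m%n<n k d)

  digitSign-odd : ∀ k → digitSign b (suc (k + k)) ≡ - digitSign b (k + k)
  digitSign-odd k = begin
      sgn (s b (suc (k + k)))                ≡⟨ cong (λ z → sgn (s b (suc z))) (double-digits k) ⟩
      sgn (s b (suc (r + r) + q * b))        ≡⟨ cong sgn (digitSum-low (suc (r + r)) q (odd-last-digit<b k)) ⟩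
      sgn (suc ((r + r) + s b q))            ≡⟨ sgn-suc ((r + r) + s b q) ⟩
      - sgn ((r + r) + s b q)                ≡⟨ cong (λ z → - sgn z) (sym (digitSum-low (r + r) q (<⇒≤ (odd-last-digit<b k)))) ⟩
      - sgn (s b ((r + r) + q * b))          ≡⟨ cong (λ z → - sgn (s b z)) (sym (double-digits k)) ⟩
      - sgn (s b (k + k))                    ∎
    where
    open ≡-Reasoning
    r q : ℕ
    r = k % d
    q = k / d

  digitSignSum-even : ∀ k → digitSignSum b (k + k) ≡ + 0
  digitSignSum-even zero    = refl
  digitSignSum-even (suc k) = begin
      digitSignSum b (suc (k + suc k))                 ≡⟨ cong (λ z → digitSignSum b (suc z)) (+-suc k k) ⟩
      (digitSignSum b (k + k) ℤ.+ g) ℤ.+ g′            ≡⟨ cong₂ (λ x y → (x ℤ.+ g) ℤ.+ y) (digitSignSum-even k) (digitSign-odd k) ⟩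
      (+ 0 ℤ.+ g) ℤ.+ (- g)                            ≡⟨ cong (ℤ._+ (- g)) (ℤP.+-identityˡ g) ⟩
      g ℤ.+ (- g)                                      ≡⟨ ℤP.+-inverseʳ g ⟩
      + 0                                              ∎
    where
    open ≡-Reasoning
    g g′ : ℤ
    g  = digitSign b (k + k)
    g′ = digitSign b (suc (k + k))

  digitSign*digitSignSum : ∀ q → digitSign b q ℤ.* digitSignSum b q ≡ minusOdd q
  digitSign*digitSignSum q with even-or-odd q
  ... | k , inj₁ refl = trans (cong (digitSign b (k + k) ℤ.*_) (digitSignSum-even k))
                              (trans (ℤP.*-zeroʳ (digitSign b (k + k))) (sym (minusOdd-even k)))
  ... | k , inj₂ refl = begin
      digitSign b (suc (k + k)) ℤ.* (digitSignSum b (k + k) ℤ.+ g)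
        ≡⟨ cong₂ (λ x y → x ℤ.* (y ℤ.+ g)) (digitSign-odd k) (digitSignSum-even k) ⟩
      (- g) ℤ.* (+ 0 ℤ.+ g)      ≡⟨ cong ((- g) ℤ.*_) (ℤP.+-identityˡ g) ⟩
      (- g) ℤ.* g                ≡⟨ sym (ℤP.neg-distribˡ-* g g) ⟩
      - (g ℤ.* g)                ≡⟨ cong -_ (sgn-sq (s b (k + k))) ⟩
      - (+ 1)                    ≡⟨ sym (minusOdd-odd k) ⟩
      minusOdd (suc (k + k))     ∎
    where
    open ≡-Reasoning
    g : ℤ
    g = digitSign b (k + k)

S-allResidues : ∀ n′ q → sumℤ (suc n′) (λ j → S (suc n′) j q) ≡ digitSignSum n′ q
S-allResidues n′ zero    = sumℤ-zero (suc n′)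
S-allResidues n′ (suc q) = begin
    sumℤ N (λ j → S N j q ℤ.+ new j)                ≡⟨ sumℤ-+ N (λ j → S N j q) new ⟩
    sumℤ N (λ j → S N j q) ℤ.+ sumℤ N new           ≡⟨ cong₂ ℤ._+_ (S-allResidues n′ q) (sumℤ-indicator N (q % N) (sgn (s n′ q)) (m%n<n q N)) ⟩
    digitSignSum n′ q ℤ.+ digitSign n′ q            ∎
  where
  open ≡-Reasoning
  N : ℕ
  N = suc n′
  new : ℕ → ℤ
  new j = if q % N ≡ᵇ j then sgn (s n′ q) else + 0

-- R_N(q, m) = Σ_{r < m, N ∣ q + r} (−1)^{s_{N−1}(r)}: the offsets r < m of a block whose first
-- index is ≡ q (mod N) that fall into the residue class 0, weighted by their own digit signs.
blockSum : ℕ → ℕ → ℕ → ℤ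
blockSum N q zero    = + 0
blockSum N q (suc m) = blockSum N q m ℤ.+ (if congb N 0 (q + m) then sgn (s (N ∸ 1) m) else + 0)

blockSum-periodic : ∀ n′ q t m → blockSum (suc n′) (q + t * suc n′) m ≡ blockSum (suc n′) q m
blockSum-periodic n′ q t zero    = refl
blockSum-periodic n′ q t (suc m) =
  cong₂ (λ x k → x ℤ.+ (if k ≡ᵇ 0 then sgn (s n′ m) else + 0)) (blockSum-periodic n′ q t m) same-residue
  where
  swap-tail : q + t * suc n′ + m ≡ q + m + t * suc n′
  swap-tail = trans (+-assoc q _ m) (trans (cong (_+_ q) (+-comm (t * suc n′) m)) (sym (+-assoc q m _)))
  same-residue : (q + t * suc n′ + m) % suc n′ ≡ (q + m) % suc n′
  same-residue = trans (cong (_% suc n′) swap-tail) ([m+kn]%n≡m%n (q + m) t (suc n′))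

block-residue : ∀ N .{{_ : NonZero N}} q P m → P % N ≡ 1 → (q * P + m) % N ≡ (q + m) % N
block-residue N q P m P≡1 = begin
    (q * P + m) % N                          ≡⟨ %-distribˡ-+ (q * P) m N ⟩
    ((q * P) % N + m % N) % N                ≡⟨ cong (λ z → (z + m % N) % N) qP≡q ⟩
    (q % N + m % N) % N                      ≡⟨ sym (%-distribˡ-+ q m N) ⟩
    (q + m) % N                              ∎
  where
  open ≡-Reasoning
  qP≡q : (q * P) % N ≡ q % N
  qP≡q = begin
    (q * P) % N                 ≡⟨ %-distribˡ-* q P N ⟩
    (q % N * (P % N)) % N       ≡⟨ cong (λ z → (q % N * z) % N) P≡1 ⟩
    (q % N * 1) % N             ≡⟨ cong (_% N) (*-identityʳ (q % N)) ⟩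
    (q % N) % N                 ≡⟨ m%n%n≡m%n q N ⟩
    q % N                       ∎

S-block : ∀ n′ q P m → P % suc n′ ≡ 1 → (∀ c → c < P → s n′ (q * P + c) ≡ s n′ q + s n′ c) → m ≤ P →
          S (suc n′) 0 (q * P + m) ≡ S (suc n′) 0 (q * P) ℤ.+ digitSign n′ q ℤ.* blockSum (suc n′) q m
S-block n′ q P zero    _   _     _   = begin
    S N 0 (q * P + 0)                      ≡⟨ cong (S N 0) (+-identityʳ (q * P)) ⟩
    S N 0 (q * P)                          ≡⟨ sym (ℤP.+-identityʳ _) ⟩
    S N 0 (q * P) ℤ.+ + 0                  ≡⟨ cong (ℤ._+_ (S N 0 (q * P))) (sym (ℤP.*-zeroʳ (digitSign n′ q))) ⟩
    S N 0 (q * P) ℤ.+ digitSign n′ q ℤ.* + 0 ∎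
  where
  open ≡-Reasoning
  N : ℕ
  N = suc n′
S-block n′ q P (suc m) P≡1 split 1+m≤P = begin
    S N 0 (q * P + suc m)
      ≡⟨ cong (S N 0) (+-suc (q * P) m) ⟩
    S N 0 (q * P + m) ℤ.+ (if (q * P + m) % N ≡ᵇ 0 then sgn (s n′ (q * P + m)) else + 0)
      ≡⟨ cong₂ (λ x k → x ℤ.+ (if k ≡ᵇ 0 then sgn (s n′ (q * P + m)) else + 0))
               (S-block n′ q P m P≡1 split (<⇒≤ 1+m≤P)) (block-residue N q P m P≡1) ⟩
    (A ℤ.+ gq ℤ.* R) ℤ.+ (if hit then sgn (s n′ (q * P + m)) else + 0)
      ≡⟨ cong (λ z → (A ℤ.+ gq ℤ.* R) ℤ.+ (if hit then sgn z else + 0)) (split m 1+m≤P) ⟩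
    (A ℤ.+ gq ℤ.* R) ℤ.+ (if hit then sgn (s n′ q + s n′ m) else + 0)
      ≡⟨ cong (λ z → (A ℤ.+ gq ℤ.* R) ℤ.+ (if hit then z else + 0)) (sgn-+ (s n′ q) (s n′ m)) ⟩
    (A ℤ.+ gq ℤ.* R) ℤ.+ (if hit then gq ℤ.* gm else + 0)
      ≡⟨ cong (ℤ._+_ (A ℤ.+ gq ℤ.* R)) (if-scale hit gq gm) ⟩
    (A ℤ.+ gq ℤ.* R) ℤ.+ gq ℤ.* (if hit then gm else + 0)
      ≡⟨ factor A gq R (if hit then gm else + 0) ⟩
    A ℤ.+ gq ℤ.* (R ℤ.+ (if hit then gm else + 0))
      ∎
  where
  open ≡-Reasoning
  N : ℕ
  N = suc n′
  A R gq gm : ℤ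
  A  = S N 0 (q * P)
  R  = blockSum N q m
  gq = digitSign n′ q
  gm = digitSign n′ m
  hit : Bool
  hit = (q + m) % N ≡ᵇ 0
  factor : ∀ a g r x → (a ℤ.+ g ℤ.* r) ℤ.+ g ℤ.* x ≡ a ℤ.+ g ℤ.* (r ℤ.+ x)
  factor = solve-∀

pow-mod-1 : ∀ N .{{_ : NonZero N}} X j → X % N ≡ 1 → (X ^ j) % N ≡ 1
pow-mod-1 N X j X≡1 = go j
  where
  one : 1 % N ≡ 1
  one = m<n⇒m%n≡m (subst (_< N) X≡1 (m%n<n X N))
  go : ∀ j → (X ^ j) % N ≡ 1
  go zero    = one
  go (suc j) = trans (%-distribˡ-* X (X ^ j) N) (trans (cong₂ (λ a c → (a * c) % N) X≡1 (go j)) one)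

div≡/ : ∀ y d .{{_ : NonZero d}} → div y d ≡ y / d
div≡/ y (suc d) = refl

div-factor : ∀ {M P Q} .{{_ : NonZero M}} .{{_ : NonZero Q}} → M ≡ P * Q → ∀ y →
             y / Q ≡ (y / M) * P + (y % M) / Q
div-factor {M} {P} {Q} M≡PQ y = begin
    y / Q                                  ≡⟨ /-congˡ y≡ ⟩
    (y % M + (y / M * P) * Q) / Q          ≡⟨ +-distrib-/-∣ʳ (y % M) (divides (y / M * P) refl) ⟩
    (y % M) / Q + (y / M * P) * Q / Q      ≡⟨ cong (_+_ ((y % M) / Q)) (m*n/n≡m (y / M * P) Q) ⟩
    (y % M) / Q + y / M * P                ≡⟨ +-comm ((y % M) / Q) (y / M * P) ⟩
    y / M * P + (y % M) / Q                ∎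
  where
  open ≡-Reasoning
  y≡ : y ≡ y % M + (y / M * P) * Q
  y≡ = trans (m≡m%n+[m/n]*n y M) (cong (λ z → y % M + z) (trans (cong (y / M *_) M≡PQ) (sym (*-assoc (y / M) P Q))))

module Periodicity (h : ℕ) where
  n B H M : ℕ
  n = suc (suc (suc (h + h)))
  B = suc (suc (h + h))
  H = ⌊ h + h /2⌋
  M = B ^ B

  instance
    M-nonZero : NonZero M
    M-nonZero = m^n≢0 B B

  open Digits (h + h) using (digitSum-concat)

  g : ℕ → ℤ
  g = digitSign B

  binom : ℕ → ℤ
  binom j = + (n C (2 * j + 1))

  σ : ℤ
  σ = sgn (suc H)

  -- B = 2(H + 1): so M = B^{2(H+1)}, and 2j ≤ B for every j ≤ H.
  B≡2[1+H] : B ≡ 2 * suc H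
  B≡2[1+H] = trans (double h) (cong (λ z → 2 * suc z) (n≡⌊n+n/2⌋ h))
    where
    double : ∀ h → suc (suc (h + h)) ≡ 2 * suc h
    double = ℕ-Ring.solve-∀

  -- B ≡ −1 (mod n), so every even power of B is ≡ 1 (mod n) ...
  evenPow-mod : ∀ j → (B ^ (2 * j)) % n ≡ 1
  evenPow-mod j = trans (cong (_% n) (sym (^-*-assoc B 2 j))) (pow-mod-1 n (B ^ 2) j B²≡1)
    where
    square : ∀ x → (2 + x) * ((2 + x) * 1) ≡ 1 + (1 + x) * (3 + x)
    square = ℕ-Ring.solve-∀
    B²≡1 : (B ^ 2) % n ≡ 1
    B²≡1 = trans (cong (_% n) (square (h + h))) ([m+kn]%n≡m%n 1 (suc (h + h)) n)

  -- ... in particular M = B^{2(H+1)}.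
  M-mod : M % n ≡ 1
  M-mod = subst (λ e → (B ^ e) % n ≡ 1) (sym B≡2[1+H]) (evenPow-mod (suc H))

  y≡qM+m : ∀ y → y ≡ (y / M) * M + y % M
  y≡qM+m y = trans (m≡m%n+[m/n]*n y M) (+-comm (y % M) _)

  g-decompose : ∀ y → g y ≡ g (y / M) ℤ.* g (y % M)
  g-decompose y = trans (cong g (y≡qM+m y))
    (trans (cong sgn (digitSum-concat B (y / M) (y % M) (m%n<n y M))) (sgn-+ (s B (y / M)) (s B (y % M))))

  S-decompose : ∀ y → S n 0 y ≡ S n 0 ((y / M) * M) ℤ.+ g (y / M) ℤ.* blockSum n (y / M) (y % M)
  S-decompose y = trans (cong (S n 0) (y≡qM+m y))
    (S-block B (y / M) M (y % M) M-mod (λ c c<M → digitSum-concat B (y / M) c c<M) (<⇒≤ (m%n<n y M)))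

  -- ⌊m/B^{B−2j}⌋, the position of ⌊y/B^{B−2j}⌋ inside its block of length B^{2j}.
  offset : ℕ → ℕ → ℕ
  offset j m = _/_ m (B ^ (B ∸ 2 * j)) {{m^n≢0 B (B ∸ 2 * j)}}

  S-coarse : ∀ j → j ≤ H → ∀ y →
             S n 0 (div y (B ^ (B ∸ 2 * j)))
               ≡ S n 0 (B ^ (2 * j) * (y / M)) ℤ.+ g (y / M) ℤ.* blockSum n (y / M) (offset j (y % M))
  S-coarse j j≤H y = begin
      S n 0 (div y Q)                        ≡⟨ cong (S n 0) (trans (div≡/ y Q) (div-factor M≡PQ y)) ⟩
      S n 0 (q * P + m′)                     ≡⟨ S-block B q P m′ (evenPow-mod j) (digitSum-concat (2 * j) q) (<⇒≤ m′<P) ⟩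
      S n 0 (q * P) ℤ.+ g q ℤ.* blockSum n q m′ ≡⟨ cong (λ z → S n 0 z ℤ.+ g q ℤ.* blockSum n q m′) (*-comm q P) ⟩
      S n 0 (P * q) ℤ.+ g q ℤ.* blockSum n q m′ ∎
    where
    open ≡-Reasoning
    P Q q m′ : ℕ
    P  = B ^ (2 * j)
    Q  = B ^ (B ∸ 2 * j)
    q  = y / M
    m′ = offset j (y % M)
    instance
      Q-nonZero : NonZero Q
      Q-nonZero = m^n≢0 B (B ∸ 2 * j)
    2j≤B : 2 * j ≤ B
    2j≤B = subst (2 * j ≤_) (sym B≡2[1+H]) (*-monoʳ-≤ 2 (m≤n⇒m≤1+n j≤H))
    M≡PQ : M ≡ P * Q
    M≡PQ = trans (cong (B ^_) (sym (m+[n∸m]≡n 2j≤B))) (^-distribˡ-+-* B (2 * j) (B ∸ 2 * j))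
    m′<P : m′ < P
    m′<P = m<n*o⇒m/o<n (subst (y % M <_) M≡PQ (m%n<n y M))

  Hypothesis : Set
  Hypothesis = (x : ℕ) → 1 ≤ x →
    sumℤ (suc (suc H)) (λ j → sgn j ℤ.* (binom j ℤ.* S n 0 (B ^ (2 * j) * x))) ≡ sumℤ n (λ j → S n j x)

  hypTerm : ℕ → ℕ → ℤ
  hypTerm q j = sgn j ℤ.* (binom j ℤ.* S n 0 (B ^ (2 * j) * q))

  hypTerm-top : ∀ q → hypTerm q (suc H) ≡ σ ℤ.* S n 0 (q * M)
  hypTerm-top q = cong (σ ℤ.*_) (begin
      binom (suc H) ℤ.* S n 0 (B ^ (2 * suc H) * q) ≡⟨ cong₂ (λ a e → (+ (n C a)) ℤ.* S n 0 (B ^ e * q)) n≡ (sym B≡2[1+H]) ⟩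
      (+ (n C n)) ℤ.* S n 0 (M * q)                 ≡⟨ cong₂ (λ a z → (+ a) ℤ.* S n 0 z) (nCn≡1 n) (*-comm M q) ⟩
      + 1 ℤ.* S n 0 (q * M)                         ≡⟨ ℤP.*-identityˡ _ ⟩
      S n 0 (q * M)                                 ∎)
    where
    open ≡-Reasoning
    n≡ : 2 * suc H + 1 ≡ n
    n≡ = trans (cong (_+ 1) (sym B≡2[1+H])) (+-comm B 1)

  coarse : ℕ → ℤ
  coarse q = sumℤ (suc H) (λ j → sgn (H ∸ j) ℤ.* (binom j ℤ.* S n 0 (B ^ (2 * j) * q)))

  coarse-reversed : ∀ q → coarse q ≡ (- σ) ℤ.* sumℤ (suc H) (hypTerm q)
  coarse-reversed q = trans (sumℤ-cong (suc H) reverse-sign) (sumℤ-*ˡ (suc H) (- σ) (hypTerm q))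
    where
    regroup : ∀ s a c x → (- (s ℤ.* a)) ℤ.* (c ℤ.* x) ≡ (- s) ℤ.* (a ℤ.* (c ℤ.* x))
    regroup = solve-∀
    reverse-sign : ∀ j → j < suc H →
      sgn (H ∸ j) ℤ.* (binom j ℤ.* S n 0 (B ^ (2 * j) * q)) ≡ (- σ) ℤ.* hypTerm q j
    reverse-sign j j<1+H = trans (cong (ℤ._* (binom j ℤ.* S n 0 (B ^ (2 * j) * q))) (sgn-∸ H j (<⇒≤pred j<1+H)))
                                 (regroup σ (sgn j) (binom j) (S n 0 (B ^ (2 * j) * q)))

  coarse-zero : coarse 0 ≡ + 0
  coarse-zero = trans (sumℤ-cong (suc H) vanish) (sumℤ-zero (suc H))
    where
    vanish : ∀ j → j < suc H → sgn (H ∸ j) ℤ.* (binom j ℤ.* S n 0 (B ^ (2 * j) * 0)) ≡ + 0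
    vanish j _ = begin
        sgn (H ∸ j) ℤ.* (binom j ℤ.* S n 0 (B ^ (2 * j) * 0)) ≡⟨ cong (λ z → sgn (H ∸ j) ℤ.* (binom j ℤ.* S n 0 z)) (*-zeroʳ (B ^ (2 * j))) ⟩
        sgn (H ∸ j) ℤ.* (binom j ℤ.* + 0)                     ≡⟨ cong (sgn (H ∸ j) ℤ.*_) (ℤP.*-zeroʳ (binom j)) ⟩
        sgn (H ∸ j) ℤ.* + 0                                   ≡⟨ ℤP.*-zeroʳ (sgn (H ∸ j)) ⟩
        + 0                                                   ∎
      where open ≡-Reasoning

  coarse-correction : Hypothesis → ∀ q → S n 0 (q * M) ℤ.- coarse q ≡ σ ℤ.* digitSignSum B q
  coarse-correction hyp zero = trans (cong (ℤ._-_ (+ 0)) coarse-zero) (sym (ℤP.*-zeroʳ σ))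
  coarse-correction hyp q@(suc _) = begin
      X ℤ.- coarse q                                     ≡⟨ cong (ℤ._-_ X) (coarse-reversed q) ⟩
      X ℤ.- ((- σ) ℤ.* Z)                                ≡⟨ unfold σ X Z ⟩
      σ ℤ.* Z ℤ.+ + 1 ℤ.* X                              ≡⟨ cong (λ u → σ ℤ.* Z ℤ.+ u ℤ.* X) (sym (sgn-sq (suc H))) ⟩
      σ ℤ.* Z ℤ.+ (σ ℤ.* σ) ℤ.* X                        ≡⟨ refold σ Z X ⟩
      σ ℤ.* (Z ℤ.+ σ ℤ.* X)                              ≡⟨ cong (λ u → σ ℤ.* (Z ℤ.+ u)) (sym (hypTerm-top q)) ⟩
      σ ℤ.* sumℤ (suc (suc H)) (hypTerm q)               ≡⟨ cong (σ ℤ.*_) (hyp q (s≤s z≤n)) ⟩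
      σ ℤ.* sumℤ n (λ j → S n j q)                       ≡⟨ cong (σ ℤ.*_) (S-allResidues B q) ⟩
      σ ℤ.* digitSignSum B q                             ∎
    where
    open ≡-Reasoning
    X Z : ℤ
    X = S n 0 (q * M)
    Z = sumℤ (suc H) (hypTerm q)
    unfold : ∀ s x z → x ℤ.- ((- s) ℤ.* z) ≡ s ℤ.* z ℤ.+ + 1 ℤ.* x
    unfold = solve-∀
    refold : ∀ s z x → s ℤ.* z ℤ.+ (s ℤ.* s) ℤ.* x ≡ s ℤ.* (z ℤ.+ s ℤ.* x)
    refold = solve-∀

  module WithJ (J : ℕ → Bool) (J-range : (j : ℕ) → J j ≡ true → 1 ≤ j × j ≤ H) (hyp : Hypothesis) where
    T : ℕ → ℕ → ℤ
    T j y = if J j then S n 0 (div y (B ^ (B ∸ 2 * j))) else S n 0 (B ^ (2 * j) * div y M)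

    ΣJ : ℕ → ℤ
    ΣJ y = sumℤ (suc H) (λ j → sgn (H ∸ j) ℤ.* (binom j ℤ.* T j y))

    f : ℕ → ℤ
    f y = g y ℤ.* (S n 0 y ℤ.- ΣJ y)

    E : ℕ → ℕ → ℕ → ℤ
    E j q m = if J j then blockSum n q (offset j m) else + 0

    Ê : ℕ → ℕ → ℤ
    Ê q m = sumℤ (suc H) (λ j → sgn (H ∸ j) ℤ.* (binom j ℤ.* E j q m))

    T-decompose : ∀ j y → T j y ≡ S n 0 (B ^ (2 * j) * (y / M)) ℤ.+ g (y / M) ℤ.* E j (y / M) (y % M)
    T-decompose j y = by-membership (J j) (λ j∈J → proj₂ (J-range j j∈J))
      where
      q m : ℕ
      q = y / M
      m = y % M
      by-membership : (c : Bool) → (c ≡ true → j ≤ H) →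
        (if c then S n 0 (div y (B ^ (B ∸ 2 * j))) else S n 0 (B ^ (2 * j) * div y M))
          ≡ S n 0 (B ^ (2 * j) * q) ℤ.+ g q ℤ.* (if c then blockSum n q (offset j m) else + 0)
      by-membership true  j≤H = S-coarse j (j≤H refl) y
      by-membership false _   = begin
          S n 0 (B ^ (2 * j) * div y M)           ≡⟨ cong (λ z → S n 0 (B ^ (2 * j) * z)) (div≡/ y M) ⟩
          S n 0 (B ^ (2 * j) * q)                 ≡⟨ sym (ℤP.+-identityʳ _) ⟩
          S n 0 (B ^ (2 * j) * q) ℤ.+ + 0         ≡⟨ cong (ℤ._+_ (S n 0 (B ^ (2 * j) * q))) (sym (ℤP.*-zeroʳ (g q))) ⟩
          S n 0 (B ^ (2 * j) * q) ℤ.+ g q ℤ.* + 0 ∎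
        where open ≡-Reasoning

    ΣJ-decompose : ∀ y → ΣJ y ≡ coarse (y / M) ℤ.+ g (y / M) ℤ.* Ê (y / M) (y % M)
    ΣJ-decompose y = begin
        ΣJ y
          ≡⟨ sumℤ-cong (suc H) (λ j _ → trans (cong (λ z → sgn (H ∸ j) ℤ.* (binom j ℤ.* z)) (T-decompose j y))
                                              (distribute (sgn (H ∸ j)) (binom j) (S n 0 (B ^ (2 * j) * q)) (g q) (E j q m))) ⟩
        sumℤ (suc H) (λ j → sgn (H ∸ j) ℤ.* (binom j ℤ.* S n 0 (B ^ (2 * j) * q)) ℤ.+ g q ℤ.* (sgn (H ∸ j) ℤ.* (binom j ℤ.* E j q m)))
          ≡⟨ sumℤ-+ (suc H) _ _ ⟩
        coarse q ℤ.+ sumℤ (suc H) (λ j → g q ℤ.* (sgn (H ∸ j) ℤ.* (binom j ℤ.* E j q m)))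
          ≡⟨ cong (ℤ._+_ (coarse q)) (sumℤ-*ˡ (suc H) (g q) _) ⟩
        coarse q ℤ.+ g q ℤ.* Ê q m
          ∎
      where
      open ≡-Reasoning
      q m : ℕ
      q = y / M
      m = y % M
      distribute : ∀ a c x r e → a ℤ.* (c ℤ.* (x ℤ.+ r ℤ.* e)) ≡ a ℤ.* (c ℤ.* x) ℤ.+ r ℤ.* (a ℤ.* (c ℤ.* e))
      distribute = solve-∀

    -- f(qM + m) as a function of q and m in which q enters only through q mod 2n.
    Φ : ℕ → ℕ → ℤ
    Φ q m = g m ℤ.* (σ ℤ.* minusOdd q) ℤ.+ g m ℤ.* (blockSum n q m ℤ.- Ê q m)

    -- f(y) = Φ(q, m): the factor g(q)² = 1 disappears and g(q)·(S(qM) − coarse(q)) = σ·ω(q).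
    f-decompose : ∀ y → f y ≡ Φ (y / M) (y % M)
    f-decompose y = begin
        f y
          ≡⟨ cong₂ ℤ._*_ (g-decompose y) (cong₂ ℤ._-_ (S-decompose y) (ΣJ-decompose y)) ⟩
        (g q ℤ.* g m) ℤ.* ((S n 0 (q * M) ℤ.+ g q ℤ.* blockSum n q m) ℤ.- (coarse q ℤ.+ g q ℤ.* Ê q m))
          ≡⟨ collect (g q) (g m) (S n 0 (q * M)) (blockSum n q m) (coarse q) (Ê q m) ⟩
        g m ℤ.* (g q ℤ.* (S n 0 (q * M) ℤ.- coarse q)) ℤ.+ (g q ℤ.* g q) ℤ.* (g m ℤ.* (blockSum n q m ℤ.- Ê q m))
          ≡⟨ cong₂ (λ u v → g m ℤ.* u ℤ.+ v ℤ.* (g m ℤ.* (blockSum n q m ℤ.- Ê q m))) main-term (sgn-sq (s B q)) ⟩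
        g m ℤ.* (σ ℤ.* minusOdd q) ℤ.+ + 1 ℤ.* (g m ℤ.* (blockSum n q m ℤ.- Ê q m))
          ≡⟨ cong (ℤ._+_ (g m ℤ.* (σ ℤ.* minusOdd q))) (ℤP.*-identityˡ _) ⟩
        Φ q m
          ∎
      where
      open ≡-Reasoning
      q m : ℕ
      q = y / M
      m = y % M
      collect : ∀ a b x r z w →
        (a ℤ.* b) ℤ.* ((x ℤ.+ a ℤ.* r) ℤ.- (z ℤ.+ a ℤ.* w)) ≡ b ℤ.* (a ℤ.* (x ℤ.- z)) ℤ.+ (a ℤ.* a) ℤ.* (b ℤ.* (r ℤ.- w))
      collect = solve-∀
      swap : ∀ a s x → a ℤ.* (s ℤ.* x) ≡ s ℤ.* (a ℤ.* x)
      swap = solve-∀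
      main-term : g q ℤ.* (S n 0 (q * M) ℤ.- coarse q) ≡ σ ℤ.* minusOdd q
      main-term = trans (cong (g q ℤ.*_) (coarse-correction hyp q))
                        (trans (swap (g q) σ (digitSignSum B q)) (cong (σ ℤ.*_) (EvenBase.digitSign*digitSignSum h q)))

    -- ω has period 2 and R_n, hence E_j and Ê, has period n in q.
    Φ-periodic : ∀ q m → Φ (q + 2 * n) m ≡ Φ q m
    Φ-periodic q m = cong₂ (λ a e → g m ℤ.* (σ ℤ.* a) ℤ.+ g m ℤ.* e) parity-term block-term
      where
      q+2n : q + 2 * n ≡ (n + n) + q
      q+2n = trans (+-comm q (2 * n)) (cong (_+ q) (cong (_+_ n) (+-identityʳ n)))
      parity-term : minusOdd (q + 2 * n) ≡ minusOdd q
      parity-term = trans (cong minusOdd q+2n) (minusOdd-periodic n q)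
      E-periodic : ∀ j → E j (q + 2 * n) m ≡ E j q m
      E-periodic j = cong (λ r → if J j then r else + 0) (blockSum-periodic B q 2 (offset j m))
      block-term : blockSum n (q + 2 * n) m ℤ.- Ê (q + 2 * n) m ≡ blockSum n q m ℤ.- Ê q m
      block-term = cong₂ ℤ._-_ (blockSum-periodic B q 2 m)
                               (sumℤ-cong (suc H) (λ j _ → cong (λ e → sgn (H ∸ j) ℤ.* (binom j ℤ.* e)) (E-periodic j)))

    -- Adding 2nM to y adds 2n to q and leaves m unchanged.
    periodic : ∀ y → f (y + 2 * n * M) ≡ f y
    periodic y = begin
        f (y + 2 * n * M)                               ≡⟨ f-decompose (y + 2 * n * M) ⟩
        Φ ((y + 2 * n * M) / M) ((y + 2 * n * M) % M)   ≡⟨ cong₂ Φ quotient ([m+kn]%n≡m%n y (2 * n) M) ⟩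
        Φ (y / M + 2 * n) (y % M)                       ≡⟨ Φ-periodic (y / M) (y % M) ⟩
        Φ (y / M) (y % M)                               ≡⟨ sym (f-decompose y) ⟩
        f y                                             ∎
      where
      open ≡-Reasoning
      quotient : (y + 2 * n * M) / M ≡ y / M + 2 * n
      quotient = trans (+-distrib-/-∣ʳ y (divides (2 * n) refl)) (cong (_+_ (y / M)) (m*n/n≡m (2 * n) M))

odd-form : ∀ k → (3 + k) % 2 ≡ 1 → ∃ λ h → k ≡ h + h
odd-form k odd with even-or-odd k
... | h , inj₁ k≡2h   = h , k≡2h
... | h , inj₂ refl   = ⊥-elim (0≢1+n (trans (sym (even-mod2 h)) odd))
  where
  even-mod2 : ∀ j → (j + j) % 2 ≡ 0
  even-mod2 zero    = refl
  even-mod2 (suc j) = trans (cong (λ z → suc z % 2) (+-suc j j)) (even-mod2 j)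

theorem10 : (n : ℕ) → 3 ≤ n → n % 2 ≡ 1
  → ((x : ℕ) → 1 ≤ x
       → sumℤ (1 + ⌊ (n ∸ 1) /2⌋) (λ j → sgn j ℤ.* ((+ (n C (2 * j + 1))) ℤ.* S n 0 ((n ∸ 1) ^ (2 * j) * x)))
         ≡ sumℤ n (λ j → S n j x))
  → (J : ℕ → Bool)
  → ((j : ℕ) → J j ≡ true → (1 ≤ j × j ≤ ⌊ (n ∸ 3) /2⌋))
  → (x : ℕ)
  → let M = (n ∸ 1) ^ (n ∸ 1)
        T = λ (j y : ℕ) → if J j then S n 0 (div y ((n ∸ 1) ^ (n ∸ 1 ∸ 2 * j))) else S n 0 ((n ∸ 1) ^ (2 * j) * div y M)
        ΣJ = λ (y : ℕ) → sumℤ (1 + ⌊ (n ∸ 3) /2⌋) (λ j → sgn (⌊ (n ∸ 3) /2⌋ ∸ j) ℤ.* ((+ (n C (2 * j + 1))) ℤ.* T j y))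
        ν = λ (y : ℕ) → S n 0 y ℤ.- ΣJ y
        f = λ (y : ℕ) → sgn (s (n ∸ 1) y) ℤ.* ν y
    in f (x + 2 * n * M) ≡ f x
theorem10 (suc (suc (suc k))) (s≤s (s≤s (s≤s z≤n))) odd hyp J J-range x with odd-form k odd
... | h , refl = Periodicity.WithJ.periodic h J J-range hyp x
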